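{- If finite simple graphs $G$ and $H$ are homeomorphic, then $G\in\mathcal{U}$ if and only if $H\in\mathcal{U}$.
   Context: Let $V$ be a finite set of Boolean variables. A clause is a disjunction of literals from $V\cup\neg V\cup\{\top,\bot\}$; a CNF is a conjunction of clauses; it is reduced if unchanged under the rules $x\vee\top=\top$, $x\vee\bot=x$, $x\wedge\top=x$, $x\wedge\bot=\bot$, $x\vee x=x$, $x\wedge x=x$, $\neg\neg x=x$, $x\vee\neg x=\top$. A nontrivial reduced 2-CNF is a reduced CNF other than $\top,\bot$ all of whose clauses have exactly two literals. With $|x|=|\neg x|=x$, its associated multigraph has as vertices the variables occurring in it and one edge $\{|a|,|b|\}$ per clause $(a\vee b)$. The 2-CNF is simple if this multigraph has no multiple edges, in which case the graph is denoted $\mathcal{G}(S)$. $\mathcal{U}$ is the family of graphs $\mathcal{G}(S)$ with $S$ an unsatisfiable simple 2-CNF (unsatisfiable: no truth assignment makes it true). A subdivision of an edge $(u,v)$ replaces it by a new vertex $w$ and edges $(u,w),(w,v)$; a subdivision of a graph is obtained by repeated edge subdivisions; two graphs are homeomorphic if they are subdivisions of the same graph. -}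

module Defs where

open import Data.Nat using (ℕ; suc)
open import Data.Fin using (Fin; zero; suc; _≟_)
open import Data.Bool using (Bool; true; false; _∧_; _∨_; not)
open import Data.List using (List; [])
open import Data.List.Relation.Unary.Any using (Any)
open import Data.List.Relation.Unary.All using (All)
open import Data.List.Relation.Unary.AllPairs using (AllPairs)
open import Data.Product using (Σ; ∃; _×_; _,_; proj₁; proj₂)
open import Data.Sum using (_⊎_)
open import Relation.Nullary using (¬_; does)
open import Relation.Binary.PropositionalEquality using (_≡_; _≢_)
open import Function.Bundles using (_↔_; Inverse; _⇔_)
open import Function.Definitions using (Injective)

record Graph : Set where
  constructor mkGraph
  field
    n   : ℕ
    adj : Fin n → Fin n → Bool
open Graph public

IsSimple : Graph → Set
IsSimple G = (∀ i j → adj G i j ≡ adj G j i) × (∀ i → adj G i i ≡ false)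

_≅_ : Graph → Graph → Set
G ≅ H = Σ (Fin (n G) ↔ Fin (n H)) λ φ →
  ∀ i j → adj G i j ≡ adj H (Inverse.to φ i) (Inverse.to φ j)

-- subdividing the edge {u,v} of K: new vertex is 'zero', old vertex i is 'suc i'
subdivide : (K : Graph) → Fin (n K) → Fin (n K) → Graph
subdivide K u v = mkGraph (suc (n K)) a
  where
  _==_ : Fin (n K) → Fin (n K) → Bool
  i == j = does (i ≟ j)
  isEnd : Fin (n K) → Bool
  isEnd j = (j == u) ∨ (j == v)
  a : Fin (suc (n K)) → Fin (suc (n K)) → Bool
  a zero    zero    = false
  a zero    (suc j) = isEnd j
  a (suc i) zero    = isEnd i
  a (suc i) (suc j) = adj K i j ∧ not (((i == u) ∧ (j == v)) ∨ ((i == v) ∧ (j == u)))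

data SubdivisionOf (K : Graph) (G : Graph) : Set where
  done : K ≅ G → SubdivisionOf K G
  step : (u v : Fin (n K)) → adj K u v ≡ true →
         SubdivisionOf (subdivide K u v) G → SubdivisionOf K G

Homeomorphic : Graph → Graph → Set
Homeomorphic G H =
  Σ Graph λ K → IsSimple K × SubdivisionOf K G × SubdivisionOf K H

record Lit (m : ℕ) : Set where
  constructor lit
  field
    var : Fin m
    pos : Bool
open Lit public

-- a 2-clause (a ∨ b); ⊤/⊥ literals cannot occur in a 2-literal reduced clause
Clause : ℕ → Set
Clause m = Lit m × Lit m

CNF2 : ℕ → Set
CNF2 m = List (Clause m)

evalLit : ∀ {m} → (Fin m → Bool) → Lit m → Bool
evalLit ρ (lit x true)  = ρ x
evalLit ρ (lit x false) = not (ρ x)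

evalClause : ∀ {m} → (Fin m → Bool) → Clause m → Bool
evalClause ρ (a , b) = evalLit ρ a ∨ evalLit ρ b

Satisfies : ∀ {m} → (Fin m → Bool) → CNF2 m → Set
Satisfies ρ S = All (λ c → evalClause ρ c ≡ true) S

Unsatisfiable : ∀ {m} → CNF2 m → Set
Unsatisfiable S = ∀ ρ → ¬ Satisfies ρ S

ReducedClause : ∀ {m} → Clause m → Set
ReducedClause (a , b) = var a ≢ var b

SameEdge : ∀ {m} → Clause m → Clause m → Set
SameEdge (a , b) (c , d) =
  (var a ≡ var c × var b ≡ var d) ⊎ (var a ≡ var d × var b ≡ var c)

Simple2CNF : ∀ {m} → CNF2 m → Set
Simple2CNF S = (S ≢ []) × All ReducedClause S × AllPairs (λ c d → ¬ SameEdge c d) S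

Occurs : ∀ {m} → CNF2 m → Fin m → Set
Occurs S x = Any (λ c → (var (proj₁ c) ≡ x) ⊎ (var (proj₂ c) ≡ x)) S

HasEdge : ∀ {m} → CNF2 m → Fin m → Fin m → Set
HasEdge S x y = Any (λ c → (var (proj₁ c) ≡ x × var (proj₂ c) ≡ y)
                          ⊎ (var (proj₁ c) ≡ y × var (proj₂ c) ≡ x)) S

-- G ≅ 𝒢(S), written out: f is a bijection from the vertices of G onto the
-- variables occurring in S, and i ~ j in G iff some clause of S has
-- variable set {f i, f j}.
IsoToGraphOf : ∀ {m} → Graph → CNF2 m → Set
IsoToGraphOf {m} G S = Σ (Fin (n G) → Fin m) λ f →
    Injective _≡_ _≡_ f
  × (∀ i → Occurs S (f i))
  × (∀ x → Occurs S x → ∃ λ i → f i ≡ x)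
  × (∀ i j → adj G i j ≡ true ⇔ HasEdge S (f i) (f j))

InU : Graph → Set
InU G = Σ ℕ λ m → Σ (CNF2 m) λ S →
  Simple2CNF S × Unsatisfiable S × IsoToGraphOf G S

-- Let w be the vertex created by subdividing the edge uv. If S realises K, replacing
-- the clause a ∨ b on {u,v} by a ∨ w and ¬ w ∨ b for a fresh variable w realises the
-- subdivided graph, and every model of the new formula satisfies a ∨ b by resolution
-- on w. Conversely, if S realises the subdivided graph, the only clauses mentioning w
-- are ℓ₁ ∨ α₁ and ℓ₂ ∨ α₂ with α₁ on u and α₂ on v; replacing them by the resolvent
-- α₁ ∨ α₂ realises K (u and v are not adjacent after subdividing, so no edge is
-- doubled), and any model of the resolvent extends to both clauses by choosing w.
-- Both steps preserve unsatisfiability, and 𝒰 is closed under isomorphism, so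
-- membership in 𝒰 is constant along a sequence of subdivisions.

module Submission where

open import Defs
open import Data.Bool using (Bool; true; false; _∧_; _∨_; not)
open import Data.Bool.Properties using (∨-comm; ∨-zeroʳ; ∧-comm)
open import Data.Empty using (⊥-elim)
open import Data.Fin using (Fin; zero; suc; _≟_; lift)
open import Data.Fin.Properties using (suc-injective; lift-injective)
open import Data.List using (_∷_; map; filter)
open import Data.List.Membership.Propositional using (_∈_; find; lose)
open import Data.List.Membership.Propositional.Properties
  using (∈-map⁺; ∈-map⁻; ∈-filter⁺; ∈-filter⁻)
open import Data.List.Relation.Unary.Any as Any using (here; there)
open import Data.List.Relation.Unary.All as All using (All; _∷_)
import Data.List.Relation.Unary.All.Properties as Allₚ
open import Data.List.Relation.Unary.AllPairs as AllPairs using (AllPairs; _∷_)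
import Data.List.Relation.Unary.AllPairs.Properties as AllPairsₚ
open import Data.Nat using (ℕ; suc)
open import Data.Product using (∃; _×_; _,_; proj₁; proj₂)
import Data.Product as Product
open import Data.Sum using (_⊎_; inj₁; inj₂; swap; [_,_]) renaming (map to ⊎-map)
open import Data.Vec.Functional using (updateAt)
open import Data.Vec.Functional.Properties using (updateAt-updates; updateAt-minimal)
open import Function using (_∘_)
open import Function.Bundles using (_⇔_; mk⇔; Equivalence; Inverse)
open import Function.Definitions using (Injective)
import Function.Properties.Equivalence as ⇔
open import Function.Properties.Inverse using (↔-sym)
open import Relation.Binary.Definitions using (DecidableEquality)
open import Relation.Binary.PropositionalEquality
  using (_≡_; _≢_; refl; sym; trans; cong; cong₂; subst)
open import Relation.Nullary using (¬_; Dec; does; yes; no; ¬?)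
open import Relation.Nullary.Decidable using (_×-dec_; _⊎-dec_)
open import Relation.Unary using (Decidable)


private
  variable
    A B : Set
    a b c d x y z : A
    m : ℕ

SamePair : A → A → A → A → Set
SamePair a b x y = (a ≡ x × b ≡ y) ⊎ (a ≡ y × b ≡ x)

samePair? : DecidableEquality A → (a b x y : A) → Dec (SamePair a b x y)
samePair? _≟_ a b x y = ((a ≟ x) ×-dec (b ≟ y)) ⊎-dec ((a ≟ y) ×-dec (b ≟ x))

SamePair-sym : SamePair a b x y → SamePair x y a b
SamePair-sym (inj₁ (p , q)) = inj₁ (sym p , sym q)
SamePair-sym (inj₂ (p , q)) = inj₂ (sym q , sym p)

SamePair-trans : SamePair a b c d → SamePair c d x y → SamePair a b x y
SamePair-trans (inj₁ (refl , refl)) q = q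
SamePair-trans (inj₂ (refl , refl)) (inj₁ (p , q)) = inj₂ (q , p)
SamePair-trans (inj₂ (refl , refl)) (inj₂ (p , q)) = inj₁ (q , p)

SamePair-mem : SamePair a b x y → a ≡ z ⊎ b ≡ z → x ≡ z ⊎ y ≡ z
SamePair-mem (inj₁ (refl , refl)) h = h
SamePair-mem (inj₂ (refl , refl)) h = swap h

SamePair-cong : (f : A → B) → SamePair a b x y → SamePair (f a) (f b) (f x) (f y)
SamePair-cong f = ⊎-map (Product.map (cong f) (cong f)) (Product.map (cong f) (cong f))

SamePair-injective : {f : A → B} → Injective _≡_ _≡_ f →
                     SamePair (f a) (f b) (f x) (f y) → SamePair a b x y
SamePair-injective inj = ⊎-map (Product.map inj inj) (Product.map inj inj)

does≡true⇔ : (a? : Dec A) → does a? ≡ true ⇔ A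
does≡true⇔ (yes a) = mk⇔ (λ _ → a) (λ _ → refl)
does≡true⇔ (no ¬a) = mk⇔ (λ ()) (λ a → ⊥-elim (¬a a))

∧-not-does≡true⇔ : ∀ {x} (b? : Dec B) → x ∧ not (does b?) ≡ true ⇔ (x ≡ true × ¬ B)
∧-not-does≡true⇔ {x = true}  (yes b) = mk⇔ (λ ()) (λ (_ , ¬b) → ⊥-elim (¬b b))
∧-not-does≡true⇔ {x = true}  (no ¬b) = mk⇔ (λ _ → refl , ¬b) (λ _ → refl)
∧-not-does≡true⇔ {x = false} _       = mk⇔ (λ ()) (λ { (() , _) })

∨-trueˡ : ∀ {x y} → x ≡ true → x ∨ y ≡ true
∨-trueˡ refl = refl

∨-trueʳ : ∀ {x y} → y ≡ true → x ∨ y ≡ true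
∨-trueʳ {x} refl = ∨-zeroʳ x

∨-resolve : ∀ x w y → x ∨ w ≡ true → not w ∨ y ≡ true → x ∨ y ≡ true
∨-resolve true  _     _ _ _  = refl
∨-resolve false true  _ _ h  = h
∨-resolve false false _ () _

module _ (K : Graph) (u v : Fin (n K)) where

  subdivide-adj-new : ∀ j → adj (subdivide K u v) zero (suc j) ≡ true ⇔ (j ≡ u ⊎ j ≡ v)
  subdivide-adj-new j = does≡true⇔ ((j ≟ u) ⊎-dec (j ≟ v))

  subdivide-adj-old : ∀ i j → adj (subdivide K u v) (suc i) (suc j) ≡ true ⇔
                              (adj K i j ≡ true × ¬ SamePair i j u v)
  subdivide-adj-old i j = ∧-not-does≡true⇔ (samePair? _≟_ i j u v)

subdivide-isSimple : ∀ {K u v} → IsSimple K → IsSimple (subdivide K u v)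
subdivide-isSimple {K} {u} {v} (K-sym , K-loopless) = symmetric , loopless
  where
  symmetric : ∀ i j → adj (subdivide K u v) i j ≡ adj (subdivide K u v) j i
  symmetric zero    zero    = refl
  symmetric zero    (suc j) = refl
  symmetric (suc i) zero    = refl
  symmetric (suc i) (suc j) rewrite K-sym i j
    | ∧-comm (does (i ≟ u)) (does (j ≟ v)) | ∧-comm (does (i ≟ v)) (does (j ≟ u))
    | ∨-comm (does (j ≟ v) ∧ does (i ≟ u)) (does (j ≟ u) ∧ does (i ≟ v)) = refl
  loopless : ∀ i → adj (subdivide K u v) i i ≡ false
  loopless zero    = refl
  loopless (suc i) rewrite K-loopless i = refl

ClauseEdge : Fin m → Fin m → Clause m → Set
ClauseEdge x y c = SamePair (var (proj₁ c)) (var (proj₂ c)) x y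

Mentions : Fin m → Clause m → Set
Mentions x c = var (proj₁ c) ≡ x ⊎ var (proj₂ c) ≡ x

clauseEdge? : (x y : Fin m) → Decidable (ClauseEdge x y)
clauseEdge? x y c = samePair? _≟_ (var (proj₁ c)) (var (proj₂ c)) x y

mentions? : (x : Fin m) → Decidable (Mentions x)
mentions? x c = (var (proj₁ c) ≟ x) ⊎-dec (var (proj₂ c) ≟ x)

mentions-other : ∀ {x : Fin m} c → Mentions x c → ∃ λ y → ClauseEdge x y c × Mentions y c
mentions-other (a , b) (inj₁ p) = var b , inj₁ (p , refl) , inj₂ refl
mentions-other (a , b) (inj₂ p) = var a , inj₂ (refl , p) , inj₁ refl

HasEdge-sym : ∀ {S : CNF2 m} {x y} → HasEdge S x y → HasEdge S y x
HasEdge-sym = Any.map swap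

reduced-¬HasEdge-loop : ∀ {S : CNF2 m} {x} → All ReducedClause S → ¬ HasEdge S x x
reduced-¬HasEdge-loop reduced loop with find loop
... | c , c∈S , inj₁ (p , q) = All.lookup reduced c∈S (trans p (sym q))
... | c , c∈S , inj₂ (p , q) = All.lookup reduced c∈S (trans p (sym q))

module _ {S : CNF2 m} (apart : AllPairs (λ c d → ¬ SameEdge c d) S) where

  apart-unique : ∀ {c d} → c ∈ S → d ∈ S → SameEdge c d → c ≡ d
  apart-unique = go apart
    where
    go : ∀ {T : CNF2 m} → AllPairs (λ c d → ¬ SameEdge c d) T →
         ∀ {c d} → c ∈ T → d ∈ T → SameEdge c d → c ≡ d
    go (_ ∷ _)  (here refl) (here refl) _ = refl
    go (p ∷ _)  (here refl) (there d∈)  s = ⊥-elim (All.lookup p d∈ s)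
    go (p ∷ _)  (there c∈)  (here refl) s = ⊥-elim (All.lookup p c∈ (SamePair-sym s))
    go (_ ∷ ps) (there c∈)  (there d∈)  s = go ps c∈ d∈ s

  ClauseEdge-unique : ∀ {c d x y} → c ∈ S → d ∈ S → ClauseEdge x y c → ClauseEdge x y d → c ≡ d
  ClauseEdge-unique c∈S d∈S c-xy d-xy =
    apart-unique c∈S d∈S (SamePair-trans c-xy (SamePair-sym d-xy))

_≋_ : Clause m → Clause m → Set
c ≋ d = ∀ ρ → evalClause ρ c ≡ evalClause ρ d

record EdgeClause (S : CNF2 m) (x y : Fin m) : Set where
  field
    clause  : Clause m
    ∈S      : clause ∈ S
    edge    : ClauseEdge x y clause
    literal : Lit m
    other   : Lit m
    var-literal : var literal ≡ x
    var-other   : var other ≡ y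
    oriented    : clause ≋ (literal , other)

edgeClause : ∀ {S : CNF2 m} {x y} → HasEdge S x y → EdgeClause S x y
edgeClause he with find he
... | (ℓ , α) , c∈S , E@(inj₁ (p , q)) = record
  { clause = ℓ , α ; ∈S = c∈S ; edge = E ; literal = ℓ ; other = α
  ; var-literal = p ; var-other = q ; oriented = λ _ → refl }
... | (α , ℓ) , c∈S , E@(inj₂ (q , p)) = record
  { clause = α , ℓ ; ∈S = c∈S ; edge = E ; literal = ℓ ; other = α
  ; var-literal = p ; var-other = q ; oriented = λ ρ → ∨-comm (evalLit ρ α) (evalLit ρ ℓ) }

liftLit : Lit m → Lit (suc m)
liftLit a = lit (suc (var a)) (pos a)

liftClause : Clause m → Clause (suc m)
liftClause (a , b) = liftLit a , liftLit b

evalLit-lift : ∀ (ρ : Fin (suc m) → Bool) a → evalLit ρ (liftLit a) ≡ evalLit (ρ ∘ suc) a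
evalLit-lift ρ (lit x true)  = refl
evalLit-lift ρ (lit x false) = refl

evalClause-lift : ∀ (ρ : Fin (suc m) → Bool) c →
                  evalClause ρ (liftClause c) ≡ evalClause (ρ ∘ suc) c
evalClause-lift ρ (a , b) = cong₂ _∨_ (evalLit-lift ρ a) (evalLit-lift ρ b)

resolve-fresh : ∀ (ρ : Fin (suc m) → Bool) a b →
                evalClause ρ (liftLit a , lit zero true) ≡ true →
                evalClause ρ (lit zero false , liftLit b) ≡ true →
                evalClause (ρ ∘ suc) (a , b) ≡ true
resolve-fresh ρ a b h₁ h₂ = ∨-resolve (evalLit (ρ ∘ suc) a) (ρ zero) (evalLit (ρ ∘ suc) b)
  (subst (λ t → t ∨ ρ zero ≡ true) (evalLit-lift ρ a) h₁)
  (subst (λ t → not (ρ zero) ∨ t ≡ true) (evalLit-lift ρ b) h₂)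

AgreeOff : Fin m → (Fin m → Bool) → (Fin m → Bool) → Set
AgreeOff x ρ′ ρ = ∀ y → y ≢ x → ρ′ y ≡ ρ y

module _ {x : Fin m} {ρ′ ρ : Fin m → Bool} (agree : AgreeOff x ρ′ ρ) where

  evalLit-agree : ∀ a → var a ≢ x → evalLit ρ′ a ≡ evalLit ρ a
  evalLit-agree (lit y true)  y≢x = agree y y≢x
  evalLit-agree (lit y false) y≢x = cong not (agree y y≢x)

  evalClause-agree : ∀ c → ¬ Mentions x c → evalClause ρ′ c ≡ evalClause ρ c
  evalClause-agree (a , b) ¬x∈c =
    cong₂ _∨_ (evalLit-agree a (¬x∈c ∘ inj₁)) (evalLit-agree b (¬x∈c ∘ inj₂))

evalLit-updateAt-self : ∀ (ρ : Fin m → Bool) ℓ →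
                        evalLit (updateAt ρ (var ℓ) (λ _ → pos ℓ)) ℓ ≡ true
evalLit-updateAt-self ρ (lit y true)  = updateAt-updates y ρ
evalLit-updateAt-self ρ (lit y false) = cong not (updateAt-updates y ρ)

updateAt-agreeOff : ∀ (ρ : Fin m → Bool) x h → AgreeOff x (updateAt ρ x h) ρ
updateAt-agreeOff ρ x h y y≢x = updateAt-minimal y x ρ y≢x

-- Set x to satisfy ℓ₂ if α₁ already holds, and ℓ₁ otherwise (then α₂ holds).
resolvent-lifts : ∀ (ρ : Fin m → Bool) {x} ℓ₁ α₁ ℓ₂ α₂ →
  var ℓ₁ ≡ x → var ℓ₂ ≡ x → var α₁ ≢ x → var α₂ ≢ x →
  evalClause ρ (α₁ , α₂) ≡ true →
  ∃ λ ρ′ → AgreeOff x ρ′ ρ × evalClause ρ′ (ℓ₁ , α₁) ≡ true × evalClause ρ′ (ℓ₂ , α₂) ≡ true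
resolvent-lifts ρ ℓ₁ α₁ ℓ₂ α₂ refl refl α₁≢x α₂≢x resolvent with evalLit ρ α₁ in α₁-holds
... | true  = _ , agree
            , ∨-trueʳ (trans (evalLit-agree agree α₁ α₁≢x) α₁-holds)
            , ∨-trueˡ (evalLit-updateAt-self ρ ℓ₂)
  where agree = updateAt-agreeOff ρ (var ℓ₂) (λ _ → pos ℓ₂)
... | false = _ , agree
            , ∨-trueˡ (evalLit-updateAt-self ρ ℓ₁)
            , ∨-trueʳ (trans (evalLit-agree agree α₂ α₂≢x) resolvent)
  where agree = updateAt-agreeOff ρ (var ℓ₁) (λ _ → pos ℓ₁)

≅-sym : ∀ {G H} → G ≅ H → H ≅ G
≅-sym {G} {H} (φ , φ-adj) = ↔-sym φ , λ i j →
  trans (cong₂ (adj H) (sym (strictlyInverseˡ i)) (sym (strictlyInverseˡ j)))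
        (sym (φ-adj (φ⁻¹ i) (φ⁻¹ j)))
  where open Inverse φ using (strictlyInverseˡ) renaming (from to φ⁻¹)

InU-transport : ∀ {G H} → H ≅ G → InU G → InU H
InU-transport {G} {H} (ψ , ψ-adj) (m , S , simple , unsat , f , f-inj , f-occ , f-onto , f-adj) =
  m , S , simple , unsat , f ∘ ψ→ , ψ→-injective ∘ f-inj , f-occ ∘ ψ→ , onto , edges
  where
  open Inverse ψ using (strictlyInverseˡ; strictlyInverseʳ) renaming (to to ψ→; from to ψ←)
  ψ→-injective : Injective _≡_ _≡_ ψ→
  ψ→-injective {i} {j} eq =
    trans (sym (strictlyInverseʳ i)) (trans (cong ψ← eq) (strictlyInverseʳ j))
  onto : ∀ x → Occurs S x → ∃ λ i → f (ψ→ i) ≡ x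
  onto x x∈S with f-onto x x∈S
  ... | i , fi≡x = ψ← i , trans (cong f (strictlyInverseˡ i)) fi≡x
  edges : ∀ i j → adj H i j ≡ true ⇔ HasEdge S (f (ψ→ i)) (f (ψ→ j))
  edges i j rewrite ψ-adj i j = f-adj (ψ→ i) (ψ→ j)

InU-resp-≅ : ∀ {G H} → G ≅ H → InU G ⇔ InU H
InU-resp-≅ iso = mk⇔ (InU-transport (≅-sym iso)) (InU-transport iso)

-- Subdividing an edge

module Split (K : Graph) (u v : Fin (n K)) {S : CNF2 m}
  (reduced : All ReducedClause S) (apart : AllPairs (λ c d → ¬ SameEdge c d) S)
  (f : Fin (n K) → Fin m) (f-inj : Injective _≡_ _≡_ f)
  (f-occ : ∀ i → Occurs S (f i)) (f-onto : ∀ x → Occurs S x → ∃ λ i → f i ≡ x)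
  (f-adj : ∀ i j → adj K i j ≡ true ⇔ HasEdge S (f i) (f j))
  (c : Clause m) (c∈S : c ∈ S) (c-uv : ClauseEdge (f u) (f v) c) where

  K′ : Graph
  K′ = subdivide K u v

  α β : Lit m
  α = proj₁ c
  β = proj₂ c

  c₁ c₂ : Clause (suc m)
  c₁ = liftLit α , lit zero true
  c₂ = lit zero false , liftLit β

  off-uv? : Decidable (λ d → ¬ ClauseEdge (f u) (f v) d)
  off-uv? d = ¬? (clauseEdge? (f u) (f v) d)

  Lifted : CNF2 (suc m)
  Lifted = map liftClause (filter off-uv? S)

  S′ : CNF2 (suc m)
  S′ = c₁ ∷ c₂ ∷ Lifted

  only-c : ∀ {d} → d ∈ S → ClauseEdge (f u) (f v) d → d ≡ c
  only-c d∈S d-uv = ClauseEdge-unique apart d∈S c∈S d-uv c-uv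

  lifted∈S′ : ∀ {d} → d ∈ S → ¬ ClauseEdge (f u) (f v) d → liftClause d ∈ S′
  lifted∈S′ d∈S ¬uv = there (there (∈-map⁺ liftClause (∈-filter⁺ off-uv? d∈S ¬uv)))

  unlift : ∀ {d′} → d′ ∈ Lifted → ∃ λ d → d′ ≡ liftClause d × d ∈ S × ¬ ClauseEdge (f u) (f v) d
  unlift d′∈ with ∈-map⁻ liftClause d′∈
  ... | d , d∈ , refl = d , refl , ∈-filter⁻ off-uv? d∈

  lifted-avoids-zero : ∀ {d′} → d′ ∈ Lifted → ¬ Mentions zero d′
  lifted-avoids-zero d′∈ with unlift d′∈
  ... | _ , refl , _ = λ { (inj₁ ()) ; (inj₂ ()) }

  satisfies-S : ∀ {ρ} → Satisfies ρ S′ → Satisfies (ρ ∘ suc) S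
  satisfies-S {ρ} sat@(sat₁ ∷ sat₂ ∷ _) = All.tabulate sat-d
    where
    sat-d : ∀ {d} → d ∈ S → evalClause (ρ ∘ suc) d ≡ true
    sat-d {d} d∈S with clauseEdge? (f u) (f v) d
    ... | yes d-uv rewrite only-c d∈S d-uv = resolve-fresh ρ α β sat₁ sat₂
    ... | no ¬uv = trans (sym (evalClause-lift ρ d)) (All.lookup sat (lifted∈S′ d∈S ¬uv))

  reduced′ : All ReducedClause S′
  reduced′ = (λ ()) ∷ (λ ()) ∷ All.tabulate reduced-lifted
    where
    reduced-lifted : ∀ {d′} → d′ ∈ Lifted → ReducedClause d′
    reduced-lifted d′∈ with unlift d′∈
    ... | d , refl , d∈S , _ = All.lookup reduced d∈S ∘ suc-injective

  apart′ : AllPairs (λ c d → ¬ SameEdge c d) S′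
  apart′ = (c₁≁c₂ ∷ All.tabulate (apart-fresh c₁ (inj₂ refl)))
         ∷ All.tabulate (apart-fresh c₂ (inj₁ refl))
         ∷ AllPairsₚ.map⁺ (AllPairsₚ.filter⁺ off-uv?
             (AllPairs.map (λ ¬same → ¬same ∘ SamePair-injective suc-injective) apart))
    where
    c₁≁c₂ : ¬ SameEdge c₁ c₂
    c₁≁c₂ (inj₁ (() , _))
    c₁≁c₂ (inj₂ (α≡β , _)) = All.lookup reduced c∈S (suc-injective α≡β)
    apart-fresh : ∀ e {d′} → Mentions zero e → d′ ∈ Lifted → ¬ SameEdge e d′
    apart-fresh _ zero∈e d′∈ same = lifted-avoids-zero d′∈ (SamePair-mem same zero∈e)

  f′ : Fin (n K′) → Fin (suc m)
  f′ = lift 1 f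

  f′-occ : ∀ i → Occurs S′ (f′ i)
  f′-occ zero = here (inj₂ refl)
  f′-occ (suc i) with find (f-occ i)
  ... | d , d∈S , fi∈d with clauseEdge? (f u) (f v) d
  ... | no ¬uv = lose (lifted∈S′ d∈S ¬uv) (⊎-map (cong suc) (cong suc) fi∈d)
  ... | yes d-uv with only-c d∈S d-uv | fi∈d
  ... | refl | inj₁ α-fi = here (inj₁ (cong suc α-fi))
  ... | refl | inj₂ β-fi = there (here (inj₂ (cong suc β-fi)))

  f′-onto-lifted : ∀ {x y} → Occurs S y → suc y ≡ x → ∃ λ i → f′ i ≡ x
  f′-onto-lifted {y = y} y∈S e with f-onto y y∈S
  ... | i , fi≡y = suc i , trans (cong suc fi≡y) e

  f′-onto : ∀ x → Occurs S′ x → ∃ λ i → f′ i ≡ x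
  f′-onto x x∈S′ with find x∈S′
  ... | _ , here refl , inj₁ e              = f′-onto-lifted (lose c∈S (inj₁ refl)) e
  ... | _ , here refl , inj₂ e              = zero , e
  ... | _ , there (here refl) , inj₁ e      = zero , e
  ... | _ , there (here refl) , inj₂ e      = f′-onto-lifted (lose c∈S (inj₂ refl)) e
  ... | _ , there (there d′∈) , x∈d′ with unlift d′∈
  ...   | d , refl , d∈S , _ =
    [ f′-onto-lifted (lose d∈S (inj₁ refl)) , f′-onto-lifted (lose d∈S (inj₂ refl)) ] x∈d′

  new-adj : ∀ j → adj K′ zero (suc j) ≡ true ⇔ HasEdge S′ zero (suc (f j))
  new-adj j = ⇔.trans (subdivide-adj-new K u v j) (mk⇔ to from)
    where
    end-of-c : j ≡ u ⊎ j ≡ v → var α ≡ f j ⊎ var β ≡ f j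
    end-of-c = SamePair-mem (SamePair-sym c-uv) ∘ ⊎-map (cong f ∘ sym) (cong f ∘ sym)
    end-of-uv : var α ≡ f j ⊎ var β ≡ f j → j ≡ u ⊎ j ≡ v
    end-of-uv = ⊎-map (sym ∘ f-inj) (sym ∘ f-inj) ∘ SamePair-mem c-uv
    to : j ≡ u ⊎ j ≡ v → HasEdge S′ zero (suc (f j))
    to j-end with end-of-c j-end
    ... | inj₁ α-fj = here (inj₂ (cong suc α-fj , refl))
    ... | inj₂ β-fj = there (here (inj₁ (refl , cong suc β-fj)))
    from : HasEdge S′ zero (suc (f j)) → j ≡ u ⊎ j ≡ v
    from edge with find edge
    ... | _ , here refl , inj₁ (() , _)
    ... | _ , here refl , inj₂ (α-fj , _) = end-of-uv (inj₁ (suc-injective α-fj))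
    ... | _ , there (here refl) , inj₁ (_ , β-fj) = end-of-uv (inj₂ (suc-injective β-fj))
    ... | _ , there (here refl) , inj₂ (() , _)
    ... | _ , there (there d′∈) , E =
      ⊥-elim (lifted-avoids-zero d′∈ (SamePair-mem (SamePair-sym E) (inj₁ refl)))

  old-adj : ∀ i j → adj K′ (suc i) (suc j) ≡ true ⇔ HasEdge S′ (suc (f i)) (suc (f j))
  old-adj i j = ⇔.trans (subdivide-adj-old K u v i j) (mk⇔ to from)
    where
    to : adj K i j ≡ true × ¬ SamePair i j u v → HasEdge S′ (suc (f i)) (suc (f j))
    to (ij , ¬uv) with find (Equivalence.to (f-adj i j) ij)
    ... | d , d∈S , d-ij = lose (lifted∈S′ d∈S d-off-uv) (SamePair-cong suc d-ij)
      where
      d-off-uv : ¬ ClauseEdge (f u) (f v) d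
      d-off-uv d-uv = ¬uv (SamePair-injective f-inj (SamePair-trans (SamePair-sym d-ij) d-uv))
    from : HasEdge S′ (suc (f i)) (suc (f j)) → adj K i j ≡ true × ¬ SamePair i j u v
    from edge with find edge
    ... | _ , here refl , inj₁ (_ , ())
    ... | _ , here refl , inj₂ (_ , ())
    ... | _ , there (here refl) , inj₁ (() , _)
    ... | _ , there (here refl) , inj₂ (() , _)
    ... | _ , there (there d′∈) , E with unlift d′∈
    ...   | d , refl , d∈S , d-off-uv =
      Equivalence.from (f-adj i j) (lose d∈S d-ij) ,
      λ ij-uv → d-off-uv (SamePair-trans d-ij (SamePair-cong f ij-uv))
      where
      d-ij : ClauseEdge (f i) (f j) d
      d-ij = SamePair-injective suc-injective E

  f′-adj : ∀ i j → adj K′ i j ≡ true ⇔ HasEdge S′ (f′ i) (f′ j)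
  f′-adj zero    zero    = mk⇔ (λ ()) (⊥-elim ∘ reduced-¬HasEdge-loop reduced′)
  f′-adj zero    (suc j) = new-adj j
  -- adj K′ (suc i) zero and adj K′ zero (suc i) are the same term.
  f′-adj (suc i) zero    = ⇔.trans (new-adj i) (mk⇔ HasEdge-sym HasEdge-sym)
  f′-adj (suc i) (suc j) = old-adj i j

  split : Unsatisfiable S → InU K′
  split unsat =
    suc m , S′ , ((λ ()) , reduced′ , apart′) , (λ ρ → unsat (ρ ∘ suc) ∘ satisfies-S) ,
    f′ , lift-injective f f-inj 1 , f′-occ , f′-onto , f′-adj

InU-subdivide : ∀ K u v → adj K u v ≡ true → InU K → InU (subdivide K u v)
InU-subdivide K u v uv (m , S , (_ , reduced , apart) , unsat , f , f-inj , f-occ , f-onto , f-adj)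
  with find (Equivalence.to (f-adj u v) uv)
... | c , c∈S , c-uv = Split.split K u v reduced apart f f-inj f-occ f-onto f-adj c c∈S c-uv unsat

-- Smoothing a subdivision vertex

module Smooth {K : Graph} (K-simple : IsSimple K) {u v : Fin (n K)} (uv : adj K u v ≡ true)
  {S : CNF2 m}
  (reduced : All ReducedClause S) (apart : AllPairs (λ c d → ¬ SameEdge c d) S)
  (f : Fin (n (subdivide K u v)) → Fin m) (f-inj : Injective _≡_ _≡_ f)
  (f-occ : ∀ i → Occurs S (f i)) (f-onto : ∀ x → Occurs S x → ∃ λ i → f i ≡ x)
  (f-adj : ∀ i j → adj (subdivide K u v) i j ≡ true ⇔ HasEdge S (f i) (f j))
  (at-u : EdgeClause S (f zero) (f (suc u))) (at-v : EdgeClause S (f zero) (f (suc v))) where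

  open EdgeClause at-u using () renaming
    (clause to d₁; ∈S to d₁∈S; edge to d₁-edge; literal to ℓ₁; other to α₁;
     var-literal to ℓ₁-w; var-other to α₁-u; oriented to d₁-oriented)
  open EdgeClause at-v using () renaming
    (clause to d₂; ∈S to d₂∈S; edge to d₂-edge; literal to ℓ₂; other to α₂;
     var-literal to ℓ₂-w; var-other to α₂-v; oriented to d₂-oriented)

  w : Fin m
  w = f zero

  g : Fin (n K) → Fin m
  g = f ∘ suc

  g-inj : Injective _≡_ _≡_ g
  g-inj = suc-injective ∘ f-inj

  g≢w : ∀ {i} → g i ≢ w
  g≢w gi≡w with f-inj gi≡w
  ... | ()

  avoids-w? : Decidable (λ d → ¬ Mentions w d)
  avoids-w? d = ¬? (mentions? w d)

  Rest : CNF2 m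
  Rest = filter avoids-w? S

  resolvent : Clause m
  resolvent = α₁ , α₂

  S′ : CNF2 m
  S′ = resolvent ∷ Rest

  resolvent-uv : ClauseEdge (g u) (g v) resolvent
  resolvent-uv = inj₁ (α₁-u , α₂-v)

  rest∈S′ : ∀ {d} → d ∈ S → ¬ Mentions w d → d ∈ S′
  rest∈S′ d∈S ¬w∈d = there (∈-filter⁺ avoids-w? d∈S ¬w∈d)

  neighbour-of-w : ∀ k → adj (subdivide K u v) zero k ≡ true → k ≡ suc u ⊎ k ≡ suc v
  neighbour-of-w (suc j) h =
    ⊎-map (cong suc) (cong suc) (Equivalence.to (subdivide-adj-new K u v j) h)

  clauses-at-w : ∀ {d} → d ∈ S → Mentions w d → d ≡ d₁ ⊎ d ≡ d₂
  clauses-at-w {d} d∈S w∈d with mentions-other d w∈d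
  ... | y , d-wy , y∈d with f-onto y (lose d∈S y∈d)
  ... | k , refl with neighbour-of-w k (Equivalence.from (f-adj zero k) (lose d∈S d-wy))
  ... | inj₁ refl = inj₁ (ClauseEdge-unique apart d∈S d₁∈S d-wy d₁-edge)
  ... | inj₂ refl = inj₂ (ClauseEdge-unique apart d∈S d₂∈S d-wy d₂-edge)

  satisfies-S : ∀ {ρ} → Satisfies ρ S′ → ∃ λ ρ′ → Satisfies ρ′ S
  satisfies-S {ρ} (sat-resolvent ∷ sat-rest)
    with resolvent-lifts ρ ℓ₁ α₁ ℓ₂ α₂ ℓ₁-w ℓ₂-w
           (g≢w ∘ trans (sym α₁-u)) (g≢w ∘ trans (sym α₂-v)) sat-resolvent
  ... | ρ′ , agree , sat₁ , sat₂ = ρ′ , All.tabulate sat-d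
    where
    sat-d : ∀ {d} → d ∈ S → evalClause ρ′ d ≡ true
    sat-d {d} d∈S with mentions? w d
    ... | no ¬w∈d = trans (evalClause-agree agree d ¬w∈d)
                          (All.lookup sat-rest (∈-filter⁺ avoids-w? d∈S ¬w∈d))
    ... | yes w∈d with clauses-at-w d∈S w∈d
    ... | inj₁ refl = trans (d₁-oriented ρ′) sat₁
    ... | inj₂ refl = trans (d₂-oriented ρ′) sat₂

  ¬adj-subdivided : ¬ HasEdge S (g u) (g v)
  ¬adj-subdivided uv′ =
    proj₂ (Equivalence.to (subdivide-adj-old K u v u v)
            (Equivalence.from (f-adj (suc u) (suc v)) uv′))
          (inj₁ (refl , refl))

  reduced′ : All ReducedClause S′
  reduced′ = (λ α₁≡α₂ → u≢v (g-inj (trans (sym α₁-u) (trans α₁≡α₂ α₂-v))))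
           ∷ Allₚ.filter⁺ avoids-w? reduced
    where
    u≢v : u ≢ v
    u≢v refl with trans (sym uv) (proj₂ K-simple u)
    ... | ()

  apart′ : AllPairs (λ c d → ¬ SameEdge c d) S′
  apart′ = All.tabulate resolvent-new ∷ AllPairsₚ.filter⁺ avoids-w? apart
    where
    resolvent-new : ∀ {d} → d ∈ Rest → ¬ SameEdge resolvent d
    resolvent-new d∈Rest same = ¬adj-subdivided
      (lose (proj₁ (∈-filter⁻ avoids-w? d∈Rest)) (SamePair-trans (SamePair-sym same) resolvent-uv))

  other-end : ∀ {i y} → w ≡ g i ⊎ y ≡ g i → y ≡ g i
  other-end = [ ⊥-elim ∘ g≢w ∘ sym , (λ e → e) ]

  g-occ : ∀ i → Occurs S′ (g i)
  g-occ i with find (f-occ (suc i))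
  ... | d , d∈S , gi∈d with mentions? w d
  ... | no ¬w∈d = lose (rest∈S′ d∈S ¬w∈d) gi∈d
  ... | yes w∈d with clauses-at-w d∈S w∈d
  ... | inj₁ refl = here (inj₁ (trans α₁-u (other-end (SamePair-mem d₁-edge gi∈d))))
  ... | inj₂ refl = here (inj₂ (trans α₂-v (other-end (SamePair-mem d₂-edge gi∈d))))

  g-onto : ∀ x → Occurs S′ x → ∃ λ i → g i ≡ x
  g-onto x x∈S′ with find x∈S′
  ... | _ , here refl , inj₁ α₁-x = u , trans (sym α₁-u) α₁-x
  ... | _ , here refl , inj₂ α₂-x = v , trans (sym α₂-v) α₂-x
  ... | d , there d∈Rest , x∈d with ∈-filter⁻ avoids-w? d∈Rest
  ... | d∈S , ¬w∈d with f-onto x (lose d∈S x∈d)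
  ... | zero  , refl = ⊥-elim (¬w∈d x∈d)
  ... | suc i , fi≡x = i , fi≡x

  uv-adj : ∀ {i j} → SamePair i j u v → adj K i j ≡ true
  uv-adj (inj₁ (refl , refl)) = uv
  uv-adj (inj₂ (refl , refl)) = trans (proj₁ K-simple v u) uv

  g-adj : ∀ i j → adj K i j ≡ true ⇔ HasEdge S′ (g i) (g j)
  g-adj i j = mk⇔ to from
    where
    to : adj K i j ≡ true → HasEdge S′ (g i) (g j)
    to ij with samePair? _≟_ i j u v
    ... | yes ij-uv = here (SamePair-trans resolvent-uv (SamePair-sym (SamePair-cong g ij-uv)))
    ... | no ¬ij-uv with find (Equivalence.to (f-adj (suc i) (suc j))
                               (Equivalence.from (subdivide-adj-old K u v i j) (ij , ¬ij-uv)))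
    ... | d , d∈S , d-ij = lose (rest∈S′ d∈S ([ g≢w , g≢w ] ∘ SamePair-mem d-ij)) d-ij
    from : HasEdge S′ (g i) (g j) → adj K i j ≡ true
    from edge with find edge
    ... | _ , here refl , E =
      uv-adj (SamePair-injective g-inj (SamePair-trans (SamePair-sym E) resolvent-uv))
    ... | _ , there d∈Rest , E =
      proj₁ (Equivalence.to (subdivide-adj-old K u v i j)
              (Equivalence.from (f-adj (suc i) (suc j))
                (lose (proj₁ (∈-filter⁻ avoids-w? d∈Rest)) E)))

  smooth : Unsatisfiable S → InU K
  smooth unsat =
    m , S′ , ((λ ()) , reduced′ , apart′) ,
    (λ ρ sat → let ρ′ , sat′ = satisfies-S sat in unsat ρ′ sat′) ,
    g , g-inj , g-occ , g-onto , g-adj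

InU-smooth : ∀ {K} → IsSimple K → ∀ {u v} → adj K u v ≡ true → InU (subdivide K u v) → InU K
InU-smooth {K} K-simple {u} {v} uv
  (m , S , (_ , reduced , apart) , unsat , f , f-inj , f-occ , f-onto , f-adj) =
  Smooth.smooth K-simple uv reduced apart f f-inj f-occ f-onto f-adj
    (edgeClause (edge-at-w (inj₁ refl))) (edgeClause (edge-at-w (inj₂ refl))) unsat
  where
  edge-at-w : ∀ {j} → j ≡ u ⊎ j ≡ v → HasEdge S (f zero) (f (suc j))
  edge-at-w {j} j-end =
    Equivalence.to (f-adj zero (suc j)) (Equivalence.from (subdivide-adj-new K u v j) j-end)

InU-resp-subdivision : ∀ {K G} → IsSimple K → SubdivisionOf K G → InU K ⇔ InU G
InU-resp-subdivision K-simple (done iso) = InU-resp-≅ iso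
InU-resp-subdivision {K} K-simple (step u v uv rest) =
  ⇔.trans (mk⇔ (InU-subdivide K u v uv) (InU-smooth K-simple uv))
          (InU-resp-subdivision (subdivide-isSimple K-simple) rest)

theorem4 : (G H : Graph) → IsSimple G → IsSimple H →
           Homeomorphic G H → (InU G ⇔ InU H)
theorem4 G H _ _ (K , K-simple , K⇝G , K⇝H) =
  ⇔.trans (⇔.sym (InU-resp-subdivision K-simple K⇝G)) (InU-resp-subdivision K-simple K⇝H)
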